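{- Let $F$ be a $2$-edge-coloured graph on $n \geq 2$ vertices in which $d^R(v) \geq \log_2 n$ and $d^B(v) \geq \log_2 n$ for every vertex $v \in V(F)$. Then $F$ contains an alternating cycle.
   Context: A $2$-edge-coloured graph is a finite simple graph each of whose edges is coloured red or blue. For a vertex $v$, $d^R(v)$ (resp. $d^B(v)$) is the number of red (resp. blue) edges incident to $v$. An alternating cycle is a cycle whose consecutive edges have alternating colours. -}

module Defs where

open import Data.Nat using (ℕ; suc; _≤_; _%_)
open import Data.Nat.DivMod using (m%n<n)
open import Data.Fin using (Fin; toℕ; fromℕ<)
open import Data.Maybe using (Maybe; just; nothing)
open import Data.Maybe.Properties using (≡-dec)
open import Function.Definitions using (Injective)
open import Relation.Binary.PropositionalEquality using (_≡_; _≢_)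
open import Relation.Nullary using (Dec; yes; no)

open import Data.List using (List; length; filter)
import Data.List as List
allFinL : (n : ℕ) → List (Fin n)
allFinL n = List.allFin n

data Colour : Set where
  red blue : Colour

_≟C_ : (a b : Colour) → Dec (a ≡ b)
red ≟C red = yes _≡_.refl
red ≟C blue = no (λ ())
blue ≟C red = no (λ ())
blue ≟C blue = yes _≡_.refl

-- A 2-edge-coloured finite simple graph on vertex set Fin n:
-- col u v = nothing  means no edge uv; col u v = just c  means uv is an edge of colour c.
record ColouredGraph (n : ℕ) : Set where
  field
    col    : Fin n → Fin n → Maybe Colour
    symm   : ∀ u v → col u v ≡ col v u
    irrefl : ∀ v → col v v ≡ nothing
open ColouredGraph public

degree : ∀ {n} → ColouredGraph n → Colour → Fin n → ℕ
degree {n} G c v = length (filter (λ u → ≡-dec _≟C_ (col G v u) (just c)) (allFinL n))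

next : ∀ {k} → Fin (suc k) → Fin (suc k)
next {k} i = fromℕ< (m%n<n (suc (toℕ i)) (suc k))

record AlternatingCycle {n : ℕ} (G : ColouredGraph n) : Set where
  field
    k       : ℕ
    len≥3   : 3 ≤ suc k
    vtx     : Fin (suc k) → Fin n
    distinct : Injective _≡_ _≡_ vtx
    ecol    : Fin (suc k) → Colour
    isEdge  : ∀ i → col G (vtx i) (vtx (next i)) ≡ just (ecol i)
    alt     : ∀ i → ecol i ≢ ecol (next i)

module Submission where

-- Call v a sink of a vertex colouring c if every edge at v of colour c v leads to a vertex of
-- colour c v. If some colouring has no sink, pick at each v an edge of colour c v to a vertex of
-- the other colour: the vertex colours alternate along the resulting map, hence so do the edge
-- colours along any of its periodic orbits, which is therefore an alternating cycle. Otherwise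
-- count pairs (c, v) with v a sink of c. Such a c is constant on the closed c(v)-neighbourhood
-- of v, so with k = ⌈log₂ n⌉ there are at most 2 · 2^(n-1-k) of them for each v, hence at most
-- n · 2^(n-k) ≤ 2^n pairs in total; but every colouring has a sink and the all-red colouring
-- has n ≥ 2 of them.

open import Defs
open import Data.Bool using (Bool; true; false; not; _∨_; _∧_)
open import Data.Empty using (⊥-elim)
open import Data.Fin using (Fin; zero; suc; toℕ; fromℕ<)
open import Data.Fin.Properties using (pigeonhole; toℕ-injective; toℕ-fromℕ<; toℕ<n; all?; ¬∀⟶∃¬)
  renaming (_≟_ to _≟ᶠ_)
open import Data.List using (length; filter; tabulate)
open import Data.Maybe using (Maybe; just)
open import Data.Maybe.Properties using (≡-dec; just-injective)
open import Data.Nat using (ℕ; NonZero; zero; suc; _+_; _*_; _∸_; _^_; _≤_; _<_; _%_; _/_; ⌊_/2⌋; ⌈_/2⌉; z≤n; s≤s; z<s)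
open import Data.Nat.DivMod using (m≡m%n+[m/n]*n)
open import Data.Nat.GeneralisedArithmetic using (fold; fold-+)
open import Data.Nat.Induction using (<-rec; <-wellFounded)
open import Data.Nat.Logarithm using (⌈log₂_⌉)
open import Data.Nat.Logarithm.Core using (⌈log2⌉)
open import Data.Nat.Properties
open import Algebra.Properties.CommutativeMonoid.Sum +-0-commutativeMonoid using (∑-distrib-+; sum-syntax)
open import Algebra.Properties.CommutativeSemigroup +-commutativeSemigroup using (interchange)
open import Data.Nat.Tactic.RingSolver using (solve-∀)
open import Data.Product using (∃; ∃₂; _,_; _×_; proj₁; proj₂)
import Data.Product as Prod
open import Data.Vec.Functional using (Vector; []; _∷_; head; tail)
open import Function using (_∘_; id)
open import Function.Definitions using (Injective)
open import Induction.WellFounded using (Acc; acc)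
open import Relation.Binary using (tri<; tri≈; tri>)
open import Relation.Binary.PropositionalEquality
open import Relation.Nullary using (Dec; yes; no; ¬_; does)
open import Relation.Nullary.Decidable using (dec-true; _→-dec_)
open import Relation.Unary using (Pred; Decidable)

least-witness : ∀ {p} {P : Pred ℕ p} → Decidable P →
                ∀ q → P q → ∃ λ L → P L × (∀ {m} → m < L → ¬ P m)
least-witness {P = P} P? = <-rec _ search
  where
  search : ∀ q → (∀ {m} → m < q → P m → ∃ λ L → P L × (∀ {m} → m < L → ¬ P m)) →
           P q → ∃ λ L → P L × (∀ {m} → m < L → ¬ P m)
  search q smaller Pq with anyUpTo? P? q
  ... | yes (m , m<q , Pm) = smaller m<q Pm
  ... | no  none           = q , Pq , λ m<q Pm → none (_ , m<q , Pm)

toℕ-next : ∀ {k} (i : Fin (suc k)) → toℕ (next i) ≡ suc (toℕ i) % suc k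
toℕ-next i = toℕ-fromℕ< _

module _ {A : Set} (f : A → A) where

  fold-multiple : ∀ {y} p → fold y f p ≡ y → ∀ q → fold y f (q * p) ≡ y
  fold-multiple p per zero = refl
  fold-multiple {y} p per (suc q) = begin
    fold y f (p + q * p)          ≡⟨ fold-+ y f p ⟩
    fold (fold y f (q * p)) f p   ≡⟨ cong (λ z → fold z f p) (fold-multiple p per q) ⟩
    fold y f p                    ≡⟨ per ⟩
    y                             ∎
    where open ≡-Reasoning

  fold-mod : ∀ {y} p .{{_ : NonZero p}} → fold y f p ≡ y → ∀ m → fold y f m ≡ fold y f (m % p)
  fold-mod {y} p per m = begin
    fold y f m                                   ≡⟨ cong (fold y f) (m≡m%n+[m/n]*n m p) ⟩
    fold y f (m % p + (m / p) * p)               ≡⟨ fold-+ y f (m % p) ⟩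
    fold (fold y f ((m / p) * p)) f (m % p)      ≡⟨ cong (λ z → fold z f (m % p)) (fold-multiple p per (m / p)) ⟩
    fold y f (m % p)                             ∎
    where open ≡-Reasoning

record PeriodicOrbit {A : Set} (f : A → A) : Set where
  field
    k        : ℕ
    vtx      : Fin (suc k) → A
    distinct : Injective _≡_ _≡_ vtx
    follows  : ∀ i → vtx (next i) ≡ f (vtx i)

module MinimalPeriod {A : Set} (f : A → A) (y : A) (L : ℕ)
  (periodic : fold y f (suc L) ≡ y) (minimal : ∀ {m} → m < L → fold y f (suc m) ≢ y) where

  orbit-injective : ∀ {a b} → a < b → b ≤ L → fold y f a ≢ fold y f b
  orbit-injective {a} {b} a<b b≤L fa≡fb = aperiodic (s + a) 0<s+a s+a<1+L returns
    where
    aperiodic : ∀ m → 0 < m → m < suc L → fold y f m ≢ y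
    aperiodic (suc m) _ m<L = minimal (≤-pred m<L)
    s = suc L ∸ b
    s+b≡1+L : s + b ≡ suc L
    s+b≡1+L = m∸n+n≡m (m≤n⇒m≤1+n b≤L)
    0<s+a : 0 < s + a
    0<s+a = <-≤-trans (m<n⇒0<n∸m (s≤s b≤L)) (m≤m+n s a)
    s+a<1+L : s + a < suc L
    s+a<1+L = subst (s + a <_) s+b≡1+L (+-monoʳ-< s a<b)
    returns : fold y f (s + a) ≡ y
    returns = begin
      fold y f (s + a)        ≡⟨ fold-+ y f s ⟩
      fold (fold y f a) f s   ≡⟨ cong (λ z → fold z f s) fa≡fb ⟩
      fold (fold y f b) f s   ≡⟨ fold-+ y f s ⟨
      fold y f (s + b)        ≡⟨ cong (fold y f) s+b≡1+L ⟩
      fold y f (suc L)        ≡⟨ periodic ⟩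
      y                       ∎
      where open ≡-Reasoning

  orbit : PeriodicOrbit f
  orbit = record
    { k        = L
    ; vtx      = vtx
    ; distinct = distinct
    ; follows  = follows
    }
    where
    vtx : Fin (suc L) → A
    vtx i = fold y f (toℕ i)
    distinct : Injective _≡_ _≡_ vtx
    distinct {i} {j} eq with <-cmp (toℕ i) (toℕ j)
    ... | tri< i<j _ _ = ⊥-elim (orbit-injective i<j (≤-pred (toℕ<n j)) eq)
    ... | tri≈ _ i≡j _ = toℕ-injective i≡j
    ... | tri> _ _ j<i = ⊥-elim (orbit-injective j<i (≤-pred (toℕ<n i)) (sym eq))
    follows : ∀ i → vtx (next i) ≡ f (vtx i)
    follows i = begin
      fold y f (toℕ (next i))            ≡⟨ cong (fold y f) (toℕ-next i) ⟩
      fold y f (suc (toℕ i) % suc L)     ≡⟨ fold-mod f (suc L) periodic (suc (toℕ i)) ⟨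
      fold y f (suc (toℕ i))             ∎
      where open ≡-Reasoning

recurrent-point : ∀ {n} (f : Fin n → Fin n) → Fin n → ∃₂ λ y q → fold y f (suc q) ≡ y
recurrent-point {n} f x with pigeonhole (n<1+n n) (λ (i : Fin (suc n)) → fold x f (toℕ i))
... | i , j , i<j , fi≡fj = fold x f (toℕ i) , q , returns
  where
  q = toℕ j ∸ suc (toℕ i)
  returns : fold (fold x f (toℕ i)) f (suc q) ≡ fold x f (toℕ i)
  returns = begin
    fold (fold x f (toℕ i)) f (suc q)  ≡⟨ fold-+ x f (suc q) ⟨
    fold x f (suc q + toℕ i)           ≡⟨ cong (fold x f) (trans (sym (+-suc q (toℕ i))) (m∸n+n≡m i<j)) ⟩
    fold x f (toℕ j)                   ≡⟨ fi≡fj ⟨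
    fold x f (toℕ i)                   ∎
    where open ≡-Reasoning

periodicOrbit : ∀ {n} (f : Fin n → Fin n) → Fin n → PeriodicOrbit f
periodicOrbit f x =
  let y , q , returns = recurrent-point f x
      L , periodic , minimal = least-witness (λ m → fold y f (suc m) ≟ᶠ y) q returns
  in  MinimalPeriod.orbit f y L periodic minimal

module AlternatingSuccessor {n} (G : ColouredGraph n) (c : Fin n → Colour) (f : Fin n → Fin n)
  (edge : ∀ v → col G v (f v) ≡ just (c v)) (switch : ∀ v → c (f v) ≢ c v) where

  no-fixed-point : ∀ v → f v ≢ v
  no-fixed-point v fv≡v with trans (sym (edge v)) (trans (cong (col G v) fv≡v) (irrefl G v))
  ... | ()

  no-2-cycle : ∀ v → f (f v) ≢ v
  no-2-cycle v ffv≡v = switch v (just-injective (begin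
    just (c (f v))        ≡⟨ edge (f v) ⟨
    col G (f v) (f (f v)) ≡⟨ cong (col G (f v)) ffv≡v ⟩
    col G (f v) v         ≡⟨ symm G (f v) v ⟩
    col G v (f v)         ≡⟨ edge v ⟩
    just (c v)            ∎))
    where open ≡-Reasoning

  orbit-length : ∀ k (vtx : Fin (suc k) → Fin n) → (∀ i → vtx (next i) ≡ f (vtx i)) → 3 ≤ suc k
  orbit-length zero          vtx follows = ⊥-elim (no-fixed-point _ (sym (follows zero)))
  orbit-length (suc zero)    vtx follows =
    ⊥-elim (no-2-cycle _ (sym (trans (follows (suc zero)) (cong f (follows zero)))))
  orbit-length (suc (suc k)) vtx follows = s≤s (s≤s (s≤s z≤n))

  alternatingCycle : Fin n → AlternatingCycle G
  alternatingCycle x = record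
    { k        = k
    ; len≥3    = orbit-length k vtx follows
    ; vtx      = vtx
    ; distinct = distinct
    ; ecol     = λ i → c (vtx i)
    ; isEdge   = λ i → trans (cong (col G (vtx i)) (follows i)) (edge (vtx i))
    ; alt      = λ i eq → switch (vtx i) (sym (trans eq (cong c (follows i))))
    }
    where open PeriodicOrbit (periodicOrbit f x)

Colouring : ℕ → Set
Colouring = Vector Colour

∑ᶜ : ∀ n → (Colouring n → ℕ) → ℕ
∑ᶜ zero    g = g []
∑ᶜ (suc n) g = ∑ᶜ n (λ c → g (red ∷ c)) + ∑ᶜ n (λ c → g (blue ∷ c))

-- Recursive rather than `λ _ → red`, so that it unfolds along ∑ᶜ.
allRed : ∀ n → Colouring n
allRed zero    = []
allRed (suc n) = red ∷ allRed n

allRed-red : ∀ n (v : Fin n) → allRed n v ≡ red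
allRed-red (suc n) zero    = refl
allRed-red (suc n) (suc v) = allRed-red n v

∑ᶜ-const : ∀ n k → ∑ᶜ n (λ _ → k) ≡ 2 ^ n * k
∑ᶜ-const zero    k = sym (+-identityʳ k)
∑ᶜ-const (suc n) k = begin
  ∑ᶜ n (λ _ → k) + ∑ᶜ n (λ _ → k) ≡⟨ cong₂ _+_ (∑ᶜ-const n k) (∑ᶜ-const n k) ⟩
  2 ^ n * k + 2 ^ n * k           ≡⟨ *-distribʳ-+ k (2 ^ n) (2 ^ n) ⟨
  (2 ^ n + 2 ^ n) * k             ≡⟨ cong (λ z → (2 ^ n + z) * k) (+-identityʳ (2 ^ n)) ⟨
  2 ^ suc n * k                   ∎
  where open ≡-Reasoning

∑ᶜ-mono-≤ : ∀ n {f g : Colouring n → ℕ} → (∀ c → f c ≤ g c) → ∑ᶜ n f ≤ ∑ᶜ n g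
∑ᶜ-mono-≤ zero    f≤g = f≤g []
∑ᶜ-mono-≤ (suc n) f≤g = +-mono-≤ (∑ᶜ-mono-≤ n (f≤g ∘ (red ∷_))) (∑ᶜ-mono-≤ n (f≤g ∘ (blue ∷_)))

∑ᶜ-distrib-+ : ∀ n (f g : Colouring n → ℕ) → ∑ᶜ n (λ c → f c + g c) ≡ ∑ᶜ n f + ∑ᶜ n g
∑ᶜ-distrib-+ zero    f g = refl
∑ᶜ-distrib-+ (suc n) f g =
  trans (cong₂ _+_ (∑ᶜ-distrib-+ n (f ∘ (red ∷_)) (g ∘ (red ∷_)))
                   (∑ᶜ-distrib-+ n (f ∘ (blue ∷_)) (g ∘ (blue ∷_))))
        (interchange (∑ᶜ n (f ∘ (red ∷_))) (∑ᶜ n (g ∘ (red ∷_))) (∑ᶜ n (f ∘ (blue ∷_))) (∑ᶜ n (g ∘ (blue ∷_))))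

∑ᶜ-∑-comm : ∀ n m (g : Colouring n → Fin m → ℕ) →
            ∑ᶜ n (λ c → ∑[ v < m ] g c v) ≡ ∑[ v < m ] ∑ᶜ n (λ c → g c v)
∑ᶜ-∑-comm zero    m g = refl
∑ᶜ-∑-comm (suc n) m g =
  trans (cong₂ _+_ (∑ᶜ-∑-comm n m (g ∘ (red ∷_))) (∑ᶜ-∑-comm n m (g ∘ (blue ∷_))))
        (sym (∑-distrib-+ (λ v → ∑ᶜ n (λ c → g (red ∷ c) v)) (λ v → ∑ᶜ n (λ c → g (blue ∷ c) v))))

∑ᶜ-<⇒∃< : ∀ n {f g : Colouring n → ℕ} → ∑ᶜ n f < ∑ᶜ n g → ∃ λ c → f c < g c
∑ᶜ-<⇒∃< zero    f<g = [] , f<g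
∑ᶜ-<⇒∃< (suc n) {f} {g} f<g
  with ∑ᶜ n (f ∘ (red ∷_)) <? ∑ᶜ n (g ∘ (red ∷_))
... | yes fᵣ<gᵣ = Prod.map (red ∷_) id (∑ᶜ-<⇒∃< n fᵣ<gᵣ)
... | no  fᵣ≮gᵣ = Prod.map (blue ∷_) id (∑ᶜ-<⇒∃< n (+-cancelˡ-< _ _ _ (<-≤-trans f<g (+-monoˡ-≤ _ (≮⇒≥ fᵣ≮gᵣ)))))

∑ᶜ-≤⇒∃< : ∀ n {f g : Colouring n → ℕ} → ∑ᶜ n g ≤ ∑ᶜ n f → f (allRed n) < g (allRed n) →
          ∃ λ c → g c < f c
∑ᶜ-≤⇒∃< zero    g≤f f<g = ⊥-elim (<⇒≱ f<g g≤f)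
∑ᶜ-≤⇒∃< (suc n) {f} {g} g≤f f<g
  with ∑ᶜ n (g ∘ (red ∷_)) ≤? ∑ᶜ n (f ∘ (red ∷_))
... | yes gᵣ≤fᵣ = Prod.map (red ∷_) id (∑ᶜ-≤⇒∃< n gᵣ≤fᵣ f<g)
... | no  gᵣ≰fᵣ = Prod.map (blue ∷_) id (∑ᶜ-<⇒∃< n (+-cancelˡ-< _ _ _ (≤-<-trans g≤f (+-monoˡ-< _ (≰⇒> gᵣ≰fᵣ)))))

𝟙 : Bool → ℕ
𝟙 false = 0
𝟙 true  = 1

𝟙-does-≤ : ∀ {p} {P : Set p} (P? : Dec P) {m} → (P → 1 ≤ m) → 𝟙 (does P?) ≤ m
𝟙-does-≤ (yes p) one≤m = one≤m p
𝟙-does-≤ (no _)  _     = z≤n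

size : ∀ {n} → Vector Bool n → ℕ
size {n} W = ∑[ u < n ] 𝟙 (W u)

isConstantOn : ∀ {n} → Vector Bool n → Colour → Colouring n → Bool
isConstantOn {zero}  W a c = true
isConstantOn {suc n} W a c = (not (head W) ∨ does (head c ≟C a)) ∧ isConstantOn (tail W) a (tail c)

∑ᶜ-isConstantOn : ∀ n (W : Vector Bool n) a → ∑ᶜ n (𝟙 ∘ isConstantOn W a) * 2 ^ size W ≡ 2 ^ n
∑ᶜ-isConstantOn zero    W a = refl
∑ᶜ-isConstantOn (suc n) W a with head W | ∑ᶜ-isConstantOn n (tail W) a
... | false | ih = trans (double S (2 ^ size (tail W))) (cong (2 *_) ih)
  where
  S = ∑ᶜ n (𝟙 ∘ isConstantOn (tail W) a)
  double : ∀ S x → (S + S) * x ≡ 2 * (S * x)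
  double = solve-∀
... | true  | ih with a
...   | red  = trans (cong (λ z → (S + z) * 2 ^ suc (size (tail W))) (∑ᶜ-const n 0))
                     (trans (single S (2 ^ n) (2 ^ size (tail W))) (cong (2 *_) ih))
  where
  S = ∑ᶜ n (𝟙 ∘ isConstantOn (tail W) red)
  single : ∀ S y x → (S + y * 0) * (2 * x) ≡ 2 * (S * x)
  single = solve-∀
...   | blue = trans (cong (λ z → (z + S) * 2 ^ suc (size (tail W))) (∑ᶜ-const n 0))
                     (trans (single S (2 ^ n) (2 ^ size (tail W))) (cong (2 *_) ih))
  where
  S = ∑ᶜ n (𝟙 ∘ isConstantOn (tail W) blue)
  single : ∀ S y x → (y * 0 + S) * (2 * x) ≡ 2 * (S * x)
  single = solve-∀

isConstantOn-complete : ∀ {n} (W : Vector Bool n) a c → (∀ u → W u ≡ true → c u ≡ a) →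
                        isConstantOn W a c ≡ true
isConstantOn-complete {zero}  W a c constant = refl
isConstantOn-complete {suc n} W a c constant =
  cong₂ _∧_ head-constant (isConstantOn-complete (tail W) a (tail c) (constant ∘ suc))
  where
  head-constant : not (head W) ∨ does (head c ≟C a) ≡ true
  head-constant with head W in Wzero
  ... | false = refl
  ... | true  = dec-true (head c ≟C a) (constant zero Wzero)

size-zero : ∀ {n} (W : Vector Bool n) → size W ≡ 0 → ∀ u → W u ≡ false
size-zero {suc n} W empty u with W zero in Wzero
size-zero {suc n} W empty zero    | false = Wzero
size-zero {suc n} W empty (suc u) | false = size-zero (tail W) empty u

size-full : ∀ {n} (W : Vector Bool n) → (∀ u → W u ≡ true) → size W ≡ n
size-full {zero}  W full = refl
size-full {suc n} W full rewrite full zero = cong suc (size-full (tail W) (full ∘ suc))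

size-insert : ∀ {n} (W : Vector Bool n) v → W v ≡ false → size (λ u → does (u ≟ᶠ v) ∨ W u) ≡ suc (size W)
size-insert {suc n} W zero    v∉W rewrite v∉W = refl
size-insert {suc n} W (suc v) v∉W =
  trans (cong (𝟙 (W zero) +_) (size-insert (tail W) v v∉W)) (+-suc (𝟙 (W zero)) (size (tail W)))

length-filter-tabulate : ∀ {A : Set} {p} {P : Pred A p} (P? : Decidable P) {n} (f : Fin n → A) →
                         length (filter P? (tabulate f)) ≡ size (λ i → does (P? (f i)))
length-filter-tabulate P? {zero}  f = refl
length-filter-tabulate P? {suc n} f with does (P? (f zero))
... | true  = cong suc (length-filter-tabulate P? (f ∘ suc))
... | false = length-filter-tabulate P? (f ∘ suc)

∑-*-≤ : ∀ {n} (T : Fin n → ℕ) x B → (∀ v → T v * x ≤ B) → (∑[ v < n ] T v) * x ≤ n * B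
∑-*-≤ {zero}  T x B bound = z≤n
∑-*-≤ {suc n} T x B bound =
  ≤-trans (≤-reflexive (*-distribʳ-+ x (T zero) _))
          (+-mono-≤ (bound zero) (∑-*-≤ (T ∘ suc) x B (bound ∘ suc)))

module Sinks {n} (G : ColouredGraph n) where

  _≟ᴹ_ : (x y : Maybe Colour) → Dec (x ≡ y)
  _≟ᴹ_ = ≡-dec _≟C_

  neighbourhood : Colour → Fin n → Vector Bool n
  neighbourhood a v u = does (col G v u ≟ᴹ just a)

  closedNeighbourhood : Colour → Fin n → Vector Bool n
  closedNeighbourhood a v u = does (u ≟ᶠ v) ∨ neighbourhood a v u

  size-closedNeighbourhood : ∀ a v → size (closedNeighbourhood a v) ≡ suc (degree G a v)
  size-closedNeighbourhood a v rewrite length-filter-tabulate (λ u → col G v u ≟ᴹ just a) id =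
    size-insert (neighbourhood a v) v (cong (λ x → does (x ≟ᴹ just a)) (irrefl G v))

  IsSink : Colouring n → Fin n → Set
  IsSink c v = ∀ u → col G v u ≡ just (c v) → c u ≡ c v

  isSink? : ∀ c v → Dec (IsSink c v)
  isSink? c v = all? (λ u → (col G v u ≟ᴹ just (c v)) →-dec (c u ≟C c v))

  sinks : Colouring n → ℕ
  sinks c = size (λ v → does (isSink? c v))

  sinkless⇒alternatingCycle : ∀ c → (∀ v → ¬ IsSink c v) → Fin n → AlternatingCycle G
  sinkless⇒alternatingCycle c sinkless = AlternatingSuccessor.alternatingCycle G c successor edge switch
    where
    escape : ∀ v → ∃ λ u → ¬ (col G v u ≡ just (c v) → c u ≡ c v)
    escape v = ¬∀⟶∃¬ n _ (λ u → (col G v u ≟ᴹ just (c v)) →-dec (c u ≟C c v)) (sinkless v)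
    successor : Fin n → Fin n
    successor v = proj₁ (escape v)
    edge : ∀ v → col G v (successor v) ≡ just (c v)
    edge v with col G v (successor v) ≟ᴹ just (c v)
    ... | yes e = e
    ... | no ¬e = ⊥-elim (proj₂ (escape v) (⊥-elim ∘ ¬e))
    switch : ∀ v → c (successor v) ≢ c v
    switch v same = proj₂ (escape v) (λ _ → same)

  IsSink⇒isConstantOn : ∀ c v → IsSink c v → isConstantOn (closedNeighbourhood (c v) v) (c v) c ≡ true
  IsSink⇒isConstantOn c v sink = isConstantOn-complete _ (c v) c agree
    where
    agree : ∀ u → closedNeighbourhood (c v) v u ≡ true → c u ≡ c v
    agree u with u ≟ᶠ v | col G v u ≟ᴹ just (c v)
    ... | yes refl | _     = λ _ → refl
    ... | no _     | yes e = λ _ → sink u e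
    ... | no _     | no _  = λ ()

  sink-indicator-≤ : ∀ c v → 𝟙 (does (isSink? c v)) ≤
    𝟙 (isConstantOn (closedNeighbourhood red v) red c) + 𝟙 (isConstantOn (closedNeighbourhood blue v) blue c)
  sink-indicator-≤ c v = 𝟙-does-≤ (isSink? c v) one-constant
    where
    one-constant : IsSink c v → 1 ≤ 𝟙 (isConstantOn (closedNeighbourhood red v) red c)
                                  + 𝟙 (isConstantOn (closedNeighbourhood blue v) blue c)
    one-constant sink with c v | IsSink⇒isConstantOn c v sink
    ... | red  | constant rewrite constant = s≤s z≤n
    ... | blue | constant rewrite constant = m≤n+m 1 _

  sinkColourings-bound : ∀ k v → k ≤ degree G red v → k ≤ degree G blue v →
                         ∑ᶜ n (λ c → 𝟙 (does (isSink? c v))) * 2 ^ k ≤ 2 ^ n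
  sinkColourings-bound k v k≤red k≤blue = *-cancelˡ-≤ 2 (begin
    2 * (T * 2 ^ k)                         ≡⟨ *-comm 2 (T * 2 ^ k) ⟩
    T * 2 ^ k * 2                           ≡⟨ *-assoc T (2 ^ k) 2 ⟩
    T * (2 ^ k * 2)                         ≡⟨ cong (T *_) (*-comm (2 ^ k) 2) ⟩
    T * 2 ^ suc k                           ≤⟨ *-monoˡ-≤ (2 ^ suc k) T≤R+B ⟩
    (R red + R blue) * 2 ^ suc k            ≡⟨ *-distribʳ-+ (2 ^ suc k) (R red) (R blue) ⟩
    R red * 2 ^ suc k + R blue * 2 ^ suc k  ≤⟨ +-mono-≤ (R-bound red k≤red) (R-bound blue k≤blue) ⟩
    2 ^ n + 2 ^ n                           ≡⟨ cong (2 ^ n +_) (+-identityʳ (2 ^ n)) ⟨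
    2 * 2 ^ n                               ∎)
    where
    open ≤-Reasoning
    T = ∑ᶜ n (λ c → 𝟙 (does (isSink? c v)))
    R : Colour → ℕ
    R a = ∑ᶜ n (𝟙 ∘ isConstantOn (closedNeighbourhood a v) a)
    T≤R+B : T ≤ R red + R blue
    T≤R+B = ≤-trans (∑ᶜ-mono-≤ n (λ c → sink-indicator-≤ c v)) (≤-reflexive (∑ᶜ-distrib-+ n _ _))
    R-bound : ∀ a → k ≤ degree G a v → R a * 2 ^ suc k ≤ 2 ^ n
    R-bound a k≤deg = begin
      R a * 2 ^ suc k                              ≤⟨ *-monoʳ-≤ (R a) (^-monoʳ-≤ 2 (s≤s k≤deg)) ⟩
      R a * 2 ^ suc (degree G a v)                 ≡⟨ cong (λ m → R a * 2 ^ m) (size-closedNeighbourhood a v) ⟨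
      R a * 2 ^ size (closedNeighbourhood a v)     ≡⟨ ∑ᶜ-isConstantOn n (closedNeighbourhood a v) a ⟩
      2 ^ n                                        ∎

  sinkless-if-no-sinks : ∀ c → sinks c ≡ 0 → ∀ v → ¬ IsSink c v
  sinkless-if-no-sinks c none v sink with () ← trans (sym (dec-true (isSink? c v) sink)) (size-zero _ none v)

  sinks-allRed : sinks (allRed n) ≡ n
  sinks-allRed = size-full _ λ v → dec-true (isSink? (allRed n) v)
    λ u _ → trans (allRed-red n u) (sym (allRed-red n v))

  ∑ᶜ-sinks-≤ : ∀ k → n ≤ 2 ^ k → (∀ v → k ≤ degree G red v) → (∀ v → k ≤ degree G blue v) →
               ∑ᶜ n sinks ≤ 2 ^ n
  ∑ᶜ-sinks-≤ k n≤2^k k≤red k≤blue = *-cancelʳ-≤ (∑ᶜ n sinks) (2 ^ n) (2 ^ k) {{m^n≢0 2 k}} (begin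
    ∑ᶜ n sinks * 2 ^ k             ≡⟨ cong (_* 2 ^ k) (∑ᶜ-∑-comm n n (λ c v → 𝟙 (does (isSink? c v)))) ⟩
    (∑[ v < n ] T v) * 2 ^ k       ≤⟨ ∑-*-≤ T (2 ^ k) (2 ^ n) (λ v → sinkColourings-bound k v (k≤red v) (k≤blue v)) ⟩
    n * 2 ^ n                      ≤⟨ *-monoˡ-≤ (2 ^ n) n≤2^k ⟩
    2 ^ k * 2 ^ n                  ≡⟨ *-comm (2 ^ k) (2 ^ n) ⟩
    2 ^ n * 2 ^ k                  ∎)
    where
    open ≤-Reasoning
    T : Fin n → ℕ
    T v = ∑ᶜ n (λ c → 𝟙 (does (isSink? c v)))

n≤2*⌈n/2⌉ : ∀ n → n ≤ 2 * ⌈ n /2⌉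
n≤2*⌈n/2⌉ n = begin
  n                          ≡⟨ ⌊n/2⌋+⌈n/2⌉≡n n ⟨
  ⌊ n /2⌋ + ⌈ n /2⌉          ≤⟨ +-monoˡ-≤ ⌈ n /2⌉ (⌊n/2⌋≤⌈n/2⌉ n) ⟩
  ⌈ n /2⌉ + ⌈ n /2⌉          ≡⟨ cong (⌈ n /2⌉ +_) (+-identityʳ ⌈ n /2⌉) ⟨
  2 * ⌈ n /2⌉                ∎
  where open ≤-Reasoning

n≤2^⌈log₂n⌉ : ∀ n → n ≤ 2 ^ ⌈log₂ n ⌉
n≤2^⌈log₂n⌉ n = bound n (<-wellFounded n)
  where
  bound : ∀ n (rec : Acc _<_ n) → n ≤ 2 ^ ⌈log2⌉ n rec
  bound zero                _        = z≤n
  bound (suc zero)          _        = s≤s z≤n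
  bound n@(suc (suc m))     (acc rs) =
    ≤-trans (n≤2*⌈n/2⌉ n) (*-monoʳ-≤ 2 (bound (suc ⌈ m /2⌉) (rs (⌈n/2⌉<n m))))

corollary2p2 : (n : ℕ) → 2 ≤ n → (F : ColouredGraph n)
    → (∀ v → ⌈log₂ n ⌉ ≤ degree F red v)
    → (∀ v → ⌈log₂ n ⌉ ≤ degree F blue v)
    → AlternatingCycle F
corollary2p2 n 2≤n F red-degrees blue-degrees =
  let c , no-sinks = ∑ᶜ-≤⇒∃< n few-sinks allRed-sinks
  in  sinkless⇒alternatingCycle c (sinkless-if-no-sinks c (n<1⇒n≡0 no-sinks)) (fromℕ< (<-≤-trans z<s 2≤n))
  where
  open Sinks F
  few-sinks : ∑ᶜ n sinks ≤ ∑ᶜ n (λ _ → 1)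
  few-sinks = subst (∑ᶜ n sinks ≤_) (sym (trans (∑ᶜ-const n 1) (*-identityʳ (2 ^ n))))
                (∑ᶜ-sinks-≤ ⌈log₂ n ⌉ (n≤2^⌈log₂n⌉ n) red-degrees blue-degrees)
  allRed-sinks : 1 < sinks (allRed n)
  allRed-sinks = subst (1 <_) (sym sinks-allRed) 2≤n
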